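{- Let $G$ be a bipartite graph that has no star cutset. If $G$ has a $1$-join, then $G$ is a $4$-hole (i.e., a chordless cycle of length $4$).
   Context: A star cutset of $G$ is a pair $(x,R)$ with $x\in V(G)$ and $R\subseteq N(x)$ such that $G\setminus(\{x\}\cup R)$ is disconnected. A graph $G$ has a $1$-join if $V(G)$ can be partitioned into sets $X$ and $Y$ with $|X|\ge 2$, $|Y|\ge 2$, such that there exist sets $\emptyset\ne A\subseteq X$ and $\emptyset\ne B\subseteq Y$ with every vertex of $A$ adjacent to every vertex of $B$, and no other edges between $X$ and $Y$. -}

module Defs where

open import Data.Nat using (ℕ)
open import Data.Fin using (Fin; zero; suc)
open import Data.Bool using (Bool; true; false; not; _∧_)
open import Data.Product using (Σ; ∃; ∃-syntax; _×_; _,_)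
open import Relation.Binary.PropositionalEquality using (_≡_; _≢_)
open import Relation.Nullary using (¬_)
open import Function.Definitions using (Injective; Surjective)

record Graph : Set where
  field
    n     : ℕ
    adj   : Fin n → Fin n → Bool
    sym   : ∀ u v → adj u v ≡ adj v u
    irrefl : ∀ v → adj v v ≡ false

open Graph public

VSet : Graph → Set
VSet G = Fin (n G) → Bool

_∈_ : ∀ {m} → Fin m → (Fin m → Bool) → Set
v ∈ S = S v ≡ true

_∉_ : ∀ {m} → Fin m → (Fin m → Bool) → Set
v ∉ S = S v ≡ false

Adj : (G : Graph) → Fin (n G) → Fin (n G) → Set
Adj G u v = adj G u v ≡ true

Bipartite : Graph → Set
Bipartite G = Σ (Fin (n G) → Bool) λ c → ∀ u v → Adj G u v → c u ≢ c v

DisconnectedOn : (G : Graph) → VSet G → Set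
DisconnectedOn G S =
  Σ (VSet G) λ P → Σ (VSet G) λ Q →
    (∀ v → v ∈ S → (v ∈ P × v ∉ Q) ⊎' (v ∉ P × v ∈ Q))
    × (∀ v → v ∈ P → v ∈ S)
    × (∀ v → v ∈ Q → v ∈ S)
    × (∃[ p ] p ∈ P) × (∃[ q ] q ∈ Q)
    × (∀ p q → p ∈ P → q ∈ Q → ¬ Adj G p q)
  where
  open import Data.Sum renaming (_⊎_ to _⊎'_)

StarCutset : (G : Graph) → Fin (n G) → VSet G → Set
StarCutset G x R =
  (∀ v → v ∈ R → Adj G x v)
  × DisconnectedOn G (λ v → not (isX v) ∧ not (R v))
  where
  open import Data.Fin using (_≟_)
  open import Relation.Nullary.Decidable using (⌊_⌋)
  isX : Fin (n G) → Bool
  isX v = ⌊ v ≟ x ⌋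

HasStarCutset : Graph → Set
HasStarCutset G = Σ (Fin (n G)) λ x → Σ (VSet G) λ R → StarCutset G x R

HasOneJoin : Graph → Set
HasOneJoin G =
  Σ (VSet G) λ X →
    (∃[ x₁ ] ∃[ x₂ ] (x₁ ≢ x₂ × x₁ ∈ X × x₂ ∈ X))
    × (∃[ y₁ ] ∃[ y₂ ] (y₁ ≢ y₂ × y₁ ∉ X × y₂ ∉ X))
    × Σ (VSet G) λ A → Σ (VSet G) λ B →
        (∀ v → v ∈ A → v ∈ X) × (∀ v → v ∈ B → v ∉ X)
        × (∃[ a ] a ∈ A) × (∃[ b ] b ∈ B)
        × (∀ x y → x ∈ X → y ∉ X → adj G x y ≡ (A x ∧ B y))

C4adj : Fin 4 → Fin 4 → Bool
C4adj zero (suc zero) = true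
C4adj zero (suc (suc (suc zero))) = true
C4adj (suc zero) zero = true
C4adj (suc zero) (suc (suc zero)) = true
C4adj (suc (suc zero)) (suc zero) = true
C4adj (suc (suc zero)) (suc (suc (suc zero))) = true
C4adj (suc (suc (suc zero))) (suc (suc zero)) = true
C4adj (suc (suc (suc zero))) zero = true
C4adj _ _ = false

IsFourHole : Graph → Set
IsFourHole G =
  Σ (Fin 4 → Fin (n G)) λ f →
    Injective _≡_ _≡_ f × Surjective _≡_ _≡_ f
    × (∀ i j → adj G (f i) (f j) ≡ C4adj i j)

-- If some v ∈ X were outside A, the star of any b ∈ B with leaves A would cut v
-- off from Y ∖ {b}; hence A = X and, symmetrically, B = Y, so X is complete to Y.
-- As G has no triangle, X and Y are then stable, and a third vertex of X would be
-- cut off from x₂ by the star of x₁ with leaves Y. So G is K₂,₂, the 4-hole.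
-- Each fact about Y is the corresponding fact about X for the 1-join with its two
-- sides exchanged.
module Submission where

open import Defs
open import Data.Bool using (Bool; true; false; not; _∧_; _xor_; if_then_else_)
open import Data.Bool.Properties using (∧-comm; not-injective)
open import Data.Empty using (⊥; ⊥-elim)
open import Data.Fin using (Fin; zero; suc; _≟_)
open import Data.Product using (∃; _×_; _,_; proj₁)
open import Data.Sum using (_⊎_; inj₁; inj₂)
open import Function using (_∘_)
open import Relation.Nullary using (¬_; yes; no; does)
open import Relation.Nullary.Decidable using (⌊_⌋; dec-true; dec-false)
open import Relation.Binary.PropositionalEquality
  using (_≡_; _≢_; ≢-sym; refl; trans; cong; cong₂; module ≡-Reasoning) renaming (sym to ≡-sym)
open import Function.Definitions using (Injective; Surjective)

true≢false : true ≢ false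
true≢false ()

no-three-distinct-bools : ∀ {a b c : Bool} → a ≢ b → b ≢ c → a ≢ c → ⊥
no-three-distinct-bools {true}  {true}          a≢b _   _   = a≢b refl
no-three-distinct-bools {false} {false}         a≢b _   _   = a≢b refl
no-three-distinct-bools {true}  {false} {true}  _   _   a≢c = a≢c refl
no-three-distinct-bools {true}  {false} {false} _   b≢c _   = b≢c refl
no-three-distinct-bools {false} {true}  {true}  _   b≢c _   = b≢c refl
no-three-distinct-bools {false} {true}  {false} _   _   a≢c = a≢c refl

avoid-one-of-two : ∀ {m} {P : Fin m → Set} {u v : Fin m} → u ≢ v → P u → P v →
                   ∀ w → ∃ λ t → P t × t ≢ w
avoid-one-of-two {u = u} {v} u≢v pu pv w with u ≟ w
... | yes refl = v , pv , ≢-sym u≢v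
... | no u≢w   = u , pu , u≢w

separated : ∀ {m} {S : Fin m → Bool} {u v} → u ∈ S → v ∉ S → u ≢ v
separated u∈S v∉S refl = true≢false (trans (≡-sym u∈S) v∉S)

one-of-two-other : ∀ {A : Set} {w a b : A} → w ≡ a ⊎ w ≡ b → w ≢ a → w ≡ b
one-of-two-other (inj₁ w≡a) w≢a = ⊥-elim (w≢a w≡a)
one-of-two-other (inj₂ w≡b) _   = w≡b

record ExactlyTwo {m} (S : Fin m → Bool) : Set where
  field
    fst snd    : Fin m
    fst≢snd    : fst ≢ snd
    fst∈S      : fst ∈ S
    snd∈S      : snd ∈ S
    fst-or-snd : ∀ w → w ∈ S → w ≡ fst ⊎ w ≡ snd

C4-side : Fin 4 → Bool
C4-side zero                   = true
C4-side (suc zero)             = false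
C4-side (suc (suc zero))       = true
C4-side (suc (suc (suc zero))) = false

C4adj-xor : ∀ i j → C4adj i j ≡ C4-side i xor C4-side j
C4adj-xor zero                   = λ { zero → refl ; (suc zero) → refl ; (suc (suc zero)) → refl ; (suc (suc (suc zero))) → refl }
C4adj-xor (suc zero)             = λ { zero → refl ; (suc zero) → refl ; (suc (suc zero)) → refl ; (suc (suc (suc zero))) → refl }
C4adj-xor (suc (suc zero))       = λ { zero → refl ; (suc zero) → refl ; (suc (suc zero)) → refl ; (suc (suc (suc zero))) → refl }
C4adj-xor (suc (suc (suc zero))) = λ { zero → refl ; (suc zero) → refl ; (suc (suc zero)) → refl ; (suc (suc (suc zero))) → refl }

module _ (G : Graph) where

  private
    V : Set
    V = Fin (n G)

  bipartite⇒triangle-free : Bipartite G → ∀ {u v w} →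
                            Adj G u v → Adj G v w → Adj G u w → ⊥
  bipartite⇒triangle-free (_ , proper) uv vw uw =
    no-three-distinct-bools (proper _ _ uv) (proper _ _ vw) (proper _ _ uw)

  star-remainder : V → VSet G → VSet G
  star-remainder x R v = not ⌊ v ≟ x ⌋ ∧ not (R v)

  ∈-star-remainder : ∀ {x R v} → v ≢ x → v ∉ R → v ∈ star-remainder x R
  ∈-star-remainder {x} {R} {v} v≢x v∉R with v ≟ x
  ... | yes v≡x = ⊥-elim (v≢x v≡x)
  ... | no _ rewrite v∉R = refl

  star-remainder-∉ : ∀ {x R v} → v ∈ star-remainder x R → v ∉ R
  star-remainder-∉ {x} {R} {v} h with ⌊ v ≟ x ⌋ | R v
  ... | false | false = refl
  star-remainder-∉ () | false | true
  star-remainder-∉ () | true  | _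

  disconnected-by : (S Z : VSet G) → ∃ (λ p → p ∈ S × p ∈ Z) → ∃ (λ q → q ∈ S × q ∉ Z) →
                    (∀ u v → u ∈ S → u ∈ Z → v ∈ S → v ∉ Z → adj G u v ≡ false) →
                    DisconnectedOn G S
  disconnected-by S Z (p , p∈S , p∈Z) (q , q∈S , q∉Z) no-edge =
    (λ v → S v ∧ Z v) , (λ v → S v ∧ not (Z v)) ,
    split , (λ v → proj₁ ∘ ∈S∩Z v) , (λ v → proj₁ ∘ ∈S∖Z v) ,
    (p , ∩-intro) , (q , ∖-intro) ,
    λ u v hu hv uv → let su , zu = ∈S∩Z u hu ; sv , zv = ∈S∖Z v hv in
                     true≢false (trans (≡-sym uv) (no-edge u v su zu sv zv))
    where
    split : ∀ v → v ∈ S → ((S v ∧ Z v) ≡ true × (S v ∧ not (Z v)) ≡ false)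
                        ⊎ ((S v ∧ Z v) ≡ false × (S v ∧ not (Z v)) ≡ true)
    split v v∈S rewrite v∈S with Z v
    ... | true  = inj₁ (refl , refl)
    ... | false = inj₂ (refl , refl)
    ∈S∩Z : ∀ v → (S v ∧ Z v) ≡ true → v ∈ S × v ∈ Z
    ∈S∩Z v h with S v | Z v
    ... | true  | true = refl , refl
    ∈S∩Z v () | true  | false
    ∈S∩Z v () | false | _
    ∈S∖Z : ∀ v → (S v ∧ not (Z v)) ≡ true → v ∈ S × v ∉ Z
    ∈S∖Z v h with S v | Z v
    ... | true  | false = refl , refl
    ∈S∖Z v () | true  | true
    ∈S∖Z v () | false | _
    ∩-intro : (S p ∧ Z p) ≡ true
    ∩-intro rewrite p∈S | p∈Z = refl
    ∖-intro : (S q ∧ not (Z q)) ≡ true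
    ∖-intro rewrite q∈S | q∉Z = refl

  star-cutset-by : (x : V) (R Z : VSet G) → (∀ v → v ∈ R → Adj G x v) →
                   ∃ (λ p → p ≢ x × p ∉ R × p ∈ Z) → ∃ (λ q → q ≢ x × q ∉ R × q ∉ Z) →
                   (∀ u v → u ∉ R → u ∈ Z → v ∉ R → v ∉ Z → adj G u v ≡ false) →
                   HasStarCutset G
  star-cutset-by x R Z R⊆N (p , p≢x , p∉R , p∈Z) (q , q≢x , q∉R , q∉Z) no-edge =
    x , R , R⊆N ,
    disconnected-by (star-remainder x R) Z
      (p , ∈-star-remainder {x} {R} p≢x p∉R , p∈Z)
      (q , ∈-star-remainder {x} {R} q≢x q∉R , q∉Z)
      (λ u v su zu sv zv → no-edge u v (star-remainder-∉ {x} {R} su) zu (star-remainder-∉ {x} {R} sv) zv)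

  complete-bipartite-2-2⇒IsFourHole : (X : VSet G) → ExactlyTwo X → ExactlyTwo (not ∘ X) →
                                      (∀ u v → adj G u v ≡ X u xor X v) → IsFourHole G
  complete-bipartite-2-2⇒IsFourHole X Xs Ys complete = f , f-injective , f-surjective , f-adj
    where
    open ExactlyTwo Xs renaming (fst to x₁; snd to x₂; fst≢snd to x₁≢x₂; fst∈S to x₁∈X; snd∈S to x₂∈X; fst-or-snd to X-pair)
    open ExactlyTwo Ys renaming (fst to y₁; snd to y₂; fst≢snd to y₁≢y₂; fst∈S to y₁∉X; snd∈S to y₂∉X; fst-or-snd to Y-pair)

    f : Fin 4 → V
    f zero                   = x₁
    f (suc zero)             = y₁
    f (suc (suc zero))       = x₂
    f (suc (suc (suc zero))) = y₂

    X∘f : ∀ i → X (f i) ≡ C4-side i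
    X∘f zero                   = x₁∈X
    X∘f (suc zero)             = not-injective y₁∉X
    X∘f (suc (suc zero))       = x₂∈X
    X∘f (suc (suc (suc zero))) = not-injective y₂∉X

    index : V → Fin 4
    index v = if X v then (if does (v ≟ x₁) then zero else suc (suc zero))
                     else (if does (v ≟ y₁) then suc zero else suc (suc (suc zero)))

    index∘f : ∀ i → index (f i) ≡ i
    index∘f zero
      rewrite X∘f zero | dec-true (x₁ ≟ x₁) refl = refl
    index∘f (suc zero)
      rewrite X∘f (suc zero) | dec-true (y₁ ≟ y₁) refl = refl
    index∘f (suc (suc zero))
      rewrite X∘f (suc (suc zero)) | dec-false (x₂ ≟ x₁) (≢-sym x₁≢x₂) = refl
    index∘f (suc (suc (suc zero)))
      rewrite X∘f (suc (suc (suc zero))) | dec-false (y₂ ≟ y₁) (≢-sym y₁≢y₂) = refl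

    f∘index : ∀ v → f (index v) ≡ v
    f∘index v with X v in v∈?X
    f∘index v | true with v ≟ x₁
    ... | yes v≡x₁ = ≡-sym v≡x₁
    ... | no v≢x₁  = ≡-sym (one-of-two-other (X-pair v v∈?X) v≢x₁)
    f∘index v | false with v ≟ y₁
    ... | yes v≡y₁ = ≡-sym v≡y₁
    ... | no v≢y₁  = ≡-sym (one-of-two-other (Y-pair v (cong not v∈?X)) v≢y₁)

    f-injective : Injective _≡_ _≡_ f
    f-injective {i} {j} fi≡fj = trans (≡-sym (index∘f i)) (trans (cong index fi≡fj) (index∘f j))

    f-surjective : Surjective _≡_ _≡_ f
    f-surjective v = index v , λ { refl → f∘index v }

    f-adj : ∀ i j → adj G (f i) (f j) ≡ C4adj i j
    f-adj i j = begin
      adj G (f i) (f j)         ≡⟨ complete (f i) (f j) ⟩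
      X (f i) xor X (f j)       ≡⟨ cong₂ _xor_ (X∘f i) (X∘f j) ⟩
      C4-side i xor C4-side j   ≡⟨ ≡-sym (C4adj-xor i j) ⟩
      C4adj i j                 ∎
      where open ≡-Reasoning

record OneJoin (G : Graph) : Set where
  field
    X                : VSet G
    x₁ x₂            : Fin (n G)
    x₁≢x₂            : x₁ ≢ x₂
    x₁∈X             : x₁ ∈ X
    x₂∈X             : x₂ ∈ X
    y₁ y₂            : Fin (n G)
    y₁≢y₂            : y₁ ≢ y₂
    y₁∉X             : y₁ ∉ X
    y₂∉X             : y₂ ∉ X
    A B              : VSet G
    A⊆X              : ∀ v → v ∈ A → v ∈ X
    B∩X≡∅            : ∀ v → v ∈ B → v ∉ X
    a                : Fin (n G)
    a∈A              : a ∈ A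
    b                : Fin (n G)
    b∈B              : b ∈ B
    adj-across       : ∀ u v → u ∈ X → v ∉ X → adj G u v ≡ A u ∧ B v

module _ {G : Graph} where

  HasOneJoin⇒OneJoin : HasOneJoin G → OneJoin G
  HasOneJoin⇒OneJoin (X , (x₁ , x₂ , x₁≢x₂ , x₁∈X , x₂∈X) , (y₁ , y₂ , y₁≢y₂ , y₁∉X , y₂∉X) ,
                      A , B , A⊆X , B∩X≡∅ , (a , a∈A) , (b , b∈B) , adj-across) =
    record { X = X ; x₁ = x₁ ; x₂ = x₂ ; x₁≢x₂ = x₁≢x₂ ; x₁∈X = x₁∈X ; x₂∈X = x₂∈X
           ; y₁ = y₁ ; y₂ = y₂ ; y₁≢y₂ = y₁≢y₂ ; y₁∉X = y₁∉X ; y₂∉X = y₂∉X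
           ; A = A ; B = B ; A⊆X = A⊆X ; B∩X≡∅ = B∩X≡∅
           ; a = a ; a∈A = a∈A ; b = b ; b∈B = b∈B ; adj-across = adj-across }

  OneJoin-swap : OneJoin G → OneJoin G
  OneJoin-swap J = record
    { X = not ∘ X ; x₁ = y₁ ; x₂ = y₂ ; x₁≢x₂ = y₁≢y₂ ; x₁∈X = cong not y₁∉X ; x₂∈X = cong not y₂∉X
    ; y₁ = x₁ ; y₂ = x₂ ; y₁≢y₂ = x₁≢x₂ ; y₁∉X = cong not x₁∈X ; y₂∉X = cong not x₂∈X
    ; A = B ; B = A ; A⊆X = λ v → cong not ∘ B∩X≡∅ v ; B∩X≡∅ = λ v → cong not ∘ A⊆X v
    ; a = b ; a∈A = b∈B ; b = a ; b∈B = a∈A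
    ; adj-across = λ u v u∉X v∈X → begin
        adj G u v     ≡⟨ Graph.sym G u v ⟩
        adj G v u     ≡⟨ adj-across v u (not-injective v∈X) (not-injective u∉X) ⟩
        A v ∧ B u     ≡⟨ ∧-comm (A v) (B u) ⟩
        B u ∧ A v     ∎
    }
    where open OneJoin J
          open ≡-Reasoning

module _ {G : Graph} (bipartite : Bipartite G) (no-star-cutset : ¬ HasStarCutset G) where

  X⊆A : (J : OneJoin G) → let open OneJoin J in ∀ v → v ∈ X → v ∈ A
  X⊆A J v v∈X with A v in v∈?A | avoid-one-of-two {P = _∉ X} y₁≢y₂ y₁∉X y₂∉X b
    where open OneJoin J
  ... | true  | _              = refl
  ... | false | q , q∉X , q≢b = ⊥-elim (no-star-cutset
        (star-cutset-by G b A X A⊆N[b] (v , separated v∈X (B∩X≡∅ b b∈B) , v∈?A , v∈X)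
                                            (q , q≢b , ∉X⇒∉A q q∉X , q∉X) no-edge))
    where
    open OneJoin J
    A⊆N[b] : ∀ u → u ∈ A → Adj G b u
    A⊆N[b] u u∈A rewrite Graph.sym G b u | adj-across u b (A⊆X u u∈A) (B∩X≡∅ b b∈B) | u∈A | b∈B = refl
    ∉X⇒∉A : ∀ u → u ∉ X → u ∉ A
    ∉X⇒∉A u u∉X with A u in u∈?A
    ... | true  = ⊥-elim (separated {S = X} (A⊆X u u∈?A) u∉X refl)
    ... | false = refl
    no-edge : ∀ u w → u ∉ A → u ∈ X → w ∉ A → w ∉ X → adj G u w ≡ false
    no-edge u w u∉A u∈X _ w∉X = trans (adj-across u w u∈X w∉X) (cong (_∧ B w) u∉A)

  Y⊆B : (J : OneJoin G) → let open OneJoin J in ∀ v → v ∉ X → v ∈ B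
  Y⊆B J v v∉X = X⊆A (OneJoin-swap J) v (cong not v∉X)

  X-complete-to-Y : (J : OneJoin G) → let open OneJoin J in ∀ u v → u ∈ X → v ∉ X → Adj G u v
  X-complete-to-Y J u v u∈X v∉X
    rewrite OneJoin.adj-across J u v u∈X v∉X | X⊆A J u u∈X | Y⊆B J v v∉X = refl

  X-independent : (J : OneJoin G) → let open OneJoin J in ∀ u v → u ∈ X → v ∈ X → adj G u v ≡ false
  X-independent J u v u∈X v∈X with adj G u v in uv
  ... | false = refl
  ... | true  = ⊥-elim (bipartite⇒triangle-free G bipartite uv
                         (X-complete-to-Y J v y₁ v∈X y₁∉X) (X-complete-to-Y J u y₁ u∈X y₁∉X))
    where open OneJoin J

  X-exactly-two : (J : OneJoin G) → ExactlyTwo (OneJoin.X J)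
  X-exactly-two J = record
    { fst = x₁ ; snd = x₂ ; fst≢snd = x₁≢x₂ ; fst∈S = x₁∈X ; snd∈S = x₂∈X ; fst-or-snd = X-pair }
    where
    open OneJoin J
    X-pair : ∀ w → w ∈ X → w ≡ x₁ ⊎ w ≡ x₂
    X-pair w w∈X with w ≟ x₁ | w ≟ x₂
    ... | yes w≡x₁ | _        = inj₁ w≡x₁
    ... | no _     | yes w≡x₂ = inj₂ w≡x₂
    ... | no w≢x₁  | no w≢x₂  = ⊥-elim (no-star-cutset
          (star-cutset-by G x₁ (not ∘ X) (λ v → does (v ≟ x₂)) Y⊆N[x₁]
             (x₂ , ≢-sym x₁≢x₂ , cong not x₂∈X , dec-true (x₂ ≟ x₂) refl)
             (w , w≢x₁ , cong not w∈X , dec-false (w ≟ x₂) w≢x₂)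
             (λ u v u∈X _ v∈X _ → X-independent J u v (not-injective u∈X) (not-injective v∈X))))
      where
      Y⊆N[x₁] : ∀ v → not (X v) ≡ true → Adj G x₁ v
      Y⊆N[x₁] v v∉X = X-complete-to-Y J x₁ v x₁∈X (not-injective v∉X)

  adj≡xor : (J : OneJoin G) → let open OneJoin J in ∀ u v → adj G u v ≡ X u xor X v
  adj≡xor J u v with OneJoin.X J u in u∈?X | OneJoin.X J v in v∈?X
  ... | true  | true  = X-independent J u v u∈?X v∈?X
  ... | true  | false = X-complete-to-Y J u v u∈?X v∈?X
  ... | false | true  = trans (Graph.sym G u v) (X-complete-to-Y J v u v∈?X u∈?X)
  ... | false | false = X-independent (OneJoin-swap J) u v (cong not u∈?X) (cong not v∈?X)

lemma2p6 : (G : Graph) → Bipartite G → ¬ HasStarCutset G → HasOneJoin G → IsFourHole G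
lemma2p6 G bipartite no-star-cutset has-one-join =
  complete-bipartite-2-2⇒IsFourHole G (OneJoin.X J)
    (X-exactly-two bipartite no-star-cutset J)
    (X-exactly-two bipartite no-star-cutset (OneJoin-swap J))
    (adj≡xor bipartite no-star-cutset J)
  where
  J : OneJoin G
  J = HasOneJoin⇒OneJoin has-one-join
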